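{- Let $\varphi:M\to N$ be a morphism of matroids, where $M$ is a matroid on $[n]$, and let $I\in\mathcal B(\varphi)_{\mathrm{rank}(N)}$. Then $I\cap L_\varphi=\emptyset$, and for every $J\subset L_\varphi$ one has $I\cup J\in\mathcal B(\varphi)$ if and only if $J$ is an independent set of the restriction $M|_{L_\varphi}$ (i.e. $J$ is independent in $M$).
   Context: Let $M$ be a matroid on $[n]$ and $N$ a matroid on a finite set $E$. A morphism $\varphi:M\to N$ is a map $\varphi:[n]\to E$ such that for all $S_1\subset S_2\subset[n]$, $\mathrm{rank}_N(\varphi(S_2))-\mathrm{rank}_N(\varphi(S_1))\le\mathrm{rank}_M S_2-\mathrm{rank}_M S_1$. A basis of $\varphi$ is an independent set $I$ of $M$ with $\mathrm{rank}_N(\varphi(I))=\mathrm{rank}(N)$; $\mathcal B(\varphi)$ is the set of bases of $\varphi$ and $\mathcal B(\varphi)_k=\{I\in\mathcal B(\varphi):|I|=k\}$. An element $i\in[n]$ is a $\varphi$-loop if $\varphi(i)$ is a loop of $N$, and $L_\varphi$ is the set of $\varphi$-loops. $M|_X$ is the restriction of $M$ to $X$, whose independent sets are the independent sets of $M$ contained in $X$. -}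

module Defs where

open import Data.Nat using (ℕ; zero; suc; _+_; _≤_; _≟_)
open import Data.Fin using (Fin)
import Data.Fin as F
open import Data.Fin.Subset using (Subset; _∪_; _∩_; _⊆_; ⁅_⁆; ∣_∣; ⊤; ⊥; inside; outside; Side)
open import Data.Vec using (Vec; []; _∷_; tabulate)
open import Data.Product using (_×_)
open import Relation.Binary.PropositionalEquality using (_≡_)
open import Relation.Nullary using (does)
open import Data.Bool using (if_then_else_)

record Matroid (n : ℕ) : Set where
  field
    rank        : Subset n → ℕ
    rank-bound  : ∀ S → rank S ≤ ∣ S ∣
    rank-mono   : ∀ {S T} → S ⊆ T → rank S ≤ rank T
    rank-submod : ∀ S T → rank (S ∪ T) + rank (S ∩ T) ≤ rank S + rank T

open Matroid public

fullRank : ∀ {n} → Matroid n → ℕ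
fullRank M = rank M ⊤

Independent : ∀ {n} → Matroid n → Subset n → Set
Independent M S = rank M S ≡ ∣ S ∣

IndependentIn : ∀ {n} → (M : Matroid n) → (X : Subset n) → Subset n → Set
IndependentIn M X J = (J ⊆ X) × Independent M J

image : ∀ {n m} → (Fin n → Fin m) → Subset n → Subset m
image {zero}  φ []      = ⊥
image {suc n} φ (b ∷ S) = (if b then ⁅ φ F.zero ⁆ else ⊥) ∪ image (λ i → φ (F.suc i)) S

IsMorphism : ∀ {n m} → Matroid n → Matroid m → (Fin n → Fin m) → Set
IsMorphism M N φ = ∀ S₁ S₂ → S₁ ⊆ S₂ →
  rank N (image φ S₂) + rank M S₁ ≤ rank M S₂ + rank N (image φ S₁)

IsBasisOf : ∀ {n m} → Matroid n → Matroid m → (Fin n → Fin m) → Subset n → Set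
IsBasisOf M N φ I = Independent M I × (rank N (image φ I) ≡ fullRank N)

IsBasisOfSize : ∀ {n m} → Matroid n → Matroid m → (Fin n → Fin m) → ℕ → Subset n → Set
IsBasisOfSize M N φ k I = IsBasisOf M N φ I × (∣ I ∣ ≡ k)

IsLoop : ∀ {m} → Matroid m → Fin m → Set
IsLoop N e = rank N ⁅ e ⁆ ≡ 0

loops : ∀ {n m} → Matroid m → (Fin n → Fin m) → Subset n
loops N φ = tabulate (λ i → does (rank N ⁅ φ i ⁆ ≟ 0))

module Submission where

-- * Loop bound: for every S, rank_N(φ(S)) + |S ∩ L_φ| ≤ |S|, because a
--   φ-loop contributes nothing to the rank of the image and any other
--   element contributes at most one.  Applied to I this forces
--   I ∩ L_φ = ∅; applied to J ⊆ L_φ it gives rank_N(φ(J)) = 0.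
-- * Hence I and J are disjoint, and |I ∪ J| = |I| + |J|.
-- * (⇒) A disjoint union that is independent has independent parts
--   (subadditivity of the rank).
-- * (⇐) The morphism inequality for J ⊆ I ∪ J, together with
--   rank_N(φ(I ∪ J)) = rank N = |I| and rank_N(φ(J)) = 0, gives
--   rank_M(I ∪ J) ≥ |I| + |J|; and φ(I ∪ J) ⊇ φ(I) still spans N.

open import Defs
open import Data.Nat using (zero; suc; _+_; _≤_; s≤s)
open import Data.Nat.Properties
open import Data.Fin using (Fin)
import Data.Fin as F
open import Data.Fin.Subset using (Subset; _∪_; _∩_; _⊆_; ⊥; ⊤; ∣_∣; ⁅_⁆; _∈_)
open import Data.Fin.Subset.Properties
  using (∉⊥; ⊆⊤; ∣⊥∣≡0; ∣⁅x⁆∣≡1; p⊆p∪q; q⊆p∪q; x∈p∪q⁻; x∈p∪q⁺; x∈p∩q⁺; x∈p∩q⁻;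
         p∩q⊆p; ⊆-antisym; Empty-unique; ∪-identityˡ; drop-∷-⊆)
open import Data.Vec using ([]; _∷_; here)
open import Data.Bool using (Bool; true; false; if_then_else_)
open import Data.Product using (_×_; _,_)
open import Data.Sum using (inj₁; inj₂)
open import Function.Bundles using (_⇔_; mk⇔)
open import Relation.Nullary using (contradiction)
open import Relation.Binary.PropositionalEquality

∣p∪q∣+∣p∩q∣≡∣p∣+∣q∣ : ∀ {n} (p q : Subset n) → ∣ p ∪ q ∣ + ∣ p ∩ q ∣ ≡ ∣ p ∣ + ∣ q ∣
∣p∪q∣+∣p∩q∣≡∣p∣+∣q∣ [] [] = refl
∣p∪q∣+∣p∩q∣≡∣p∣+∣q∣ (true ∷ p) (true ∷ q) = begin
    suc (∣ p ∪ q ∣ + suc ∣ p ∩ q ∣) ≡⟨ cong suc (+-suc ∣ p ∪ q ∣ _) ⟩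
    suc (suc (∣ p ∪ q ∣ + ∣ p ∩ q ∣)) ≡⟨ cong (λ k → suc (suc k)) (∣p∪q∣+∣p∩q∣≡∣p∣+∣q∣ p q) ⟩
    suc (suc (∣ p ∣ + ∣ q ∣)) ≡⟨ cong suc (sym (+-suc ∣ p ∣ _)) ⟩
    suc (∣ p ∣ + suc ∣ q ∣) ∎
  where open ≡-Reasoning
∣p∪q∣+∣p∩q∣≡∣p∣+∣q∣ (true ∷ p) (false ∷ q) = cong suc (∣p∪q∣+∣p∩q∣≡∣p∣+∣q∣ p q)
∣p∪q∣+∣p∩q∣≡∣p∣+∣q∣ (false ∷ p) (true ∷ q) =
  trans (cong suc (∣p∪q∣+∣p∩q∣≡∣p∣+∣q∣ p q)) (sym (+-suc ∣ p ∣ _))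
∣p∪q∣+∣p∩q∣≡∣p∣+∣q∣ (false ∷ p) (false ∷ q) = ∣p∪q∣+∣p∩q∣≡∣p∣+∣q∣ p q

∣p∣≡0⇒p≡⊥ : ∀ {n} (p : Subset n) → ∣ p ∣ ≡ 0 → p ≡ ⊥
∣p∣≡0⇒p≡⊥ [] _ = refl
∣p∣≡0⇒p≡⊥ (true ∷ p) ()
∣p∣≡0⇒p≡⊥ (false ∷ p) ∣p∣≡0 = cong (false ∷_) (∣p∣≡0⇒p≡⊥ p ∣p∣≡0)

disjoint⇒∣p∪q∣≡∣p∣+∣q∣ : ∀ {n} (p q : Subset n) → p ∩ q ≡ ⊥ → ∣ p ∪ q ∣ ≡ ∣ p ∣ + ∣ q ∣
disjoint⇒∣p∪q∣≡∣p∣+∣q∣ {n} p q p∩q≡⊥ = begin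
  ∣ p ∪ q ∣                 ≡⟨ sym (+-identityʳ _) ⟩
  ∣ p ∪ q ∣ + 0             ≡⟨ cong (λ r → ∣ p ∪ q ∣ + r) (sym (∣⊥∣≡0 n)) ⟩
  ∣ p ∪ q ∣ + ∣ ⊥ {n} ∣     ≡⟨ cong (λ r → ∣ p ∪ q ∣ + ∣ r ∣) (sym p∩q≡⊥) ⟩
  ∣ p ∪ q ∣ + ∣ p ∩ q ∣     ≡⟨ ∣p∪q∣+∣p∩q∣≡∣p∣+∣q∣ p q ⟩
  ∣ p ∣ + ∣ q ∣             ∎
  where open ≡-Reasoning

⊆⇒p∩q≡p : ∀ {n} {p q : Subset n} → p ⊆ q → p ∩ q ≡ p
⊆⇒p∩q≡p {p = p} {q} p⊆q = ⊆-antisym (p∩q⊆p p q) (λ x∈p → x∈p∩q⁺ (x∈p , p⊆q x∈p))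

disjoint-⊆ : ∀ {n} {p q r : Subset n} → p ∩ q ≡ ⊥ → r ⊆ q → p ∩ r ≡ ⊥
disjoint-⊆ {p = p} {q} {r} p∩q≡⊥ r⊆q = Empty-unique λ where
  (x , x∈p∩r) → let (x∈p , x∈r) = x∈p∩q⁻ p r x∈p∩r in
                ∉⊥ (subst (x ∈_) p∩q≡⊥ (x∈p∩q⁺ (x∈p , r⊆q x∈r)))

rank-⊥ : ∀ {n} (M : Matroid n) → rank M ⊥ ≡ 0
rank-⊥ {n} M = n≤0⇒n≡0 (≤-trans (rank-bound M ⊥) (≤-reflexive (∣⊥∣≡0 n)))

rank-subadditive : ∀ {n} (M : Matroid n) S T → rank M (S ∪ T) ≤ rank M S + rank M T
rank-subadditive M S T = ≤-trans (m≤m+n _ _) (rank-submod M S T)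

independent-disjoint-part : ∀ {n} (M : Matroid n) (S T : Subset n) → S ∩ T ≡ ⊥ →
  Independent M (S ∪ T) → Independent M T
independent-disjoint-part M S T S∩T≡⊥ indS∪T =
  ≤-antisym (rank-bound M T) (+-cancelˡ-≤ ∣ S ∣ _ _ (begin
    ∣ S ∣ + ∣ T ∣           ≡⟨ sym (disjoint⇒∣p∪q∣≡∣p∣+∣q∣ S T S∩T≡⊥) ⟩
    ∣ S ∪ T ∣               ≡⟨ sym indS∪T ⟩
    rank M (S ∪ T)          ≤⟨ rank-subadditive M S T ⟩
    rank M S + rank M T     ≤⟨ +-monoˡ-≤ (rank M T) (rank-bound M S) ⟩
    ∣ S ∣ + rank M T        ∎))
  where open ≤-Reasoning

head-image-mono : ∀ {n m} {b c : Bool} {S T : Subset n} (A : Subset m) →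
  (b ∷ S) ⊆ (c ∷ T) → (if b then A else ⊥) ⊆ (if c then A else ⊥)
head-image-mono {b = false} A _ x∈⊥ = contradiction x∈⊥ ∉⊥
head-image-mono {b = true} {true} A _ x∈A = x∈A
head-image-mono {b = true} {false} A bS⊆cT _ = contradiction (bS⊆cT here) λ ()

image-mono : ∀ {n m} (φ : Fin n → Fin m) {S T : Subset n} → S ⊆ T → image φ S ⊆ image φ T
image-mono φ {[]} {[]} _ x∈ = x∈
image-mono φ {b ∷ S} {c ∷ T} bS⊆cT x∈ with x∈p∪q⁻ _ _ x∈
... | inj₁ x∈head = x∈p∪q⁺ (inj₁ (head-image-mono ⁅ φ F.zero ⁆ bS⊆cT x∈head))
... | inj₂ x∈tail = x∈p∪q⁺ (inj₂ (image-mono (λ i → φ (F.suc i)) (drop-∷-⊆ bS⊆cT) x∈tail))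

-- Every element of S outside L_φ raises rank_N(φ(S)) by at most one and
-- every φ-loop raises it by nothing, so the φ-loops of S are "lost".
loop-bound : ∀ {n m} (N : Matroid m) (φ : Fin n → Fin m) (S : Subset n) →
  rank N (image φ S) + ∣ S ∩ loops N φ ∣ ≤ ∣ S ∣
loop-bound N φ [] = ≤-reflexive (cong (_+ 0) (rank-⊥ N))
loop-bound {suc n} {m} N φ (false ∷ S) = begin
    rank N (⊥ ∪ image ψ S) + ∣ S ∩ loops N ψ ∣ ≡⟨ cong (λ A → rank N A + ∣ S ∩ loops N ψ ∣) (∪-identityˡ _) ⟩
    rank N (image ψ S) + ∣ S ∩ loops N ψ ∣     ≤⟨ loop-bound N ψ S ⟩
    ∣ S ∣                                      ∎
  where open ≤-Reasoning
        ψ : Fin n → Fin m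
        ψ i = φ (F.suc i)
loop-bound {suc n} {m} N φ (true ∷ S) with rank N ⁅ φ F.zero ⁆ in e-rank
... | zero = begin
    rank N (⁅ e ⁆ ∪ image ψ S) + suc ∣ S ∩ loops N ψ ∣   ≡⟨ +-suc _ _ ⟩
    suc (rank N (⁅ e ⁆ ∪ image ψ S) + ∣ S ∩ loops N ψ ∣) ≤⟨ s≤s (+-monoˡ-≤ _ rank-e∪) ⟩
    suc (rank N (image ψ S) + ∣ S ∩ loops N ψ ∣)         ≤⟨ s≤s (loop-bound N ψ S) ⟩
    suc ∣ S ∣                                            ∎
  where open ≤-Reasoning
        e : Fin m
        e = φ F.zero
        ψ : Fin n → Fin m
        ψ i = φ (F.suc i)
        rank-e∪ : rank N (⁅ e ⁆ ∪ image ψ S) ≤ rank N (image ψ S)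
        rank-e∪ = ≤-trans (rank-subadditive N ⁅ e ⁆ (image ψ S))
                          (≤-reflexive (cong (_+ rank N (image ψ S)) e-rank))
... | suc _ = begin
    rank N (⁅ e ⁆ ∪ image ψ S) + ∣ S ∩ loops N ψ ∣ ≤⟨ +-monoˡ-≤ _ rank-e∪ ⟩
    suc (rank N (image ψ S)) + ∣ S ∩ loops N ψ ∣   ≤⟨ s≤s (loop-bound N ψ S) ⟩
    suc ∣ S ∣                                      ∎
  where open ≤-Reasoning
        e : Fin m
        e = φ F.zero
        ψ : Fin n → Fin m
        ψ i = φ (F.suc i)
        rank-e∪ : rank N (⁅ e ⁆ ∪ image ψ S) ≤ suc (rank N (image ψ S))
        rank-e∪ = ≤-trans (rank-subadditive N ⁅ e ⁆ (image ψ S))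
                          (+-monoˡ-≤ _ (≤-trans (rank-bound N ⁅ e ⁆) (≤-reflexive (∣⁅x⁆∣≡1 e))))

image-rank-full⇒no-loops : ∀ {n m} (N : Matroid m) (φ : Fin n → Fin m) (S : Subset n) →
  rank N (image φ S) ≡ ∣ S ∣ → S ∩ loops N φ ≡ ⊥
image-rank-full⇒no-loops N φ S rank≡∣S∣ =
  ∣p∣≡0⇒p≡⊥ (S ∩ loops N φ) (n≤0⇒n≡0 (+-cancelˡ-≤ ∣ S ∣ _ _ (begin
    ∣ S ∣ + ∣ S ∩ loops N φ ∣              ≡⟨ cong (_+ ∣ S ∩ loops N φ ∣) (sym rank≡∣S∣) ⟩
    rank N (image φ S) + ∣ S ∩ loops N φ ∣ ≤⟨ loop-bound N φ S ⟩
    ∣ S ∣                                  ≡⟨ sym (+-identityʳ ∣ S ∣) ⟩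
    ∣ S ∣ + 0                              ∎)))
  where open ≤-Reasoning

loops-image-rank-zero : ∀ {n m} (N : Matroid m) (φ : Fin n → Fin m) (J : Subset n) →
  J ⊆ loops N φ → rank N (image φ J) ≡ 0
loops-image-rank-zero N φ J J⊆L = n≤0⇒n≡0 (+-cancelʳ-≤ ∣ J ∣ _ _ (begin
  rank N (image φ J) + ∣ J ∣              ≡⟨ cong (λ K → rank N (image φ J) + ∣ K ∣) (sym (⊆⇒p∩q≡p J⊆L)) ⟩
  rank N (image φ J) + ∣ J ∩ loops N φ ∣  ≤⟨ loop-bound N φ J ⟩
  ∣ J ∣                                   ∎))
  where open ≤-Reasoning

spanning-superset : ∀ {n m} (N : Matroid m) (φ : Fin n → Fin m) {S T : Subset n} →
  rank N (image φ S) ≡ fullRank N → S ⊆ T → rank N (image φ T) ≡ fullRank N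
spanning-superset N φ spanS S⊆T =
  ≤-antisym (rank-mono N ⊆⊤) (≤-trans (≤-reflexive (sym spanS)) (rank-mono N (image-mono φ S⊆T)))

-- Adding to S an independent set T, disjoint from S, whose image has rank
-- zero, keeps independence as long as φ(S ∪ T) has rank at least |S|:
-- the morphism inequality for T ⊆ S ∪ T bounds rank_M(S ∪ T) from below.
morphism-extends-independence : ∀ {n m} (M : Matroid n) (N : Matroid m) (φ : Fin n → Fin m) →
  IsMorphism M N φ → (S T : Subset n) → S ∩ T ≡ ⊥ →
  ∣ S ∣ ≤ rank N (image φ (S ∪ T)) → rank N (image φ T) ≡ 0 → Independent M T →
  Independent M (S ∪ T)
morphism-extends-independence M N φ mor S T S∩T≡⊥ ∣S∣≤rankφS∪T rankφT≡0 indT =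
  ≤-antisym (rank-bound M (S ∪ T)) (begin
    ∣ S ∪ T ∣                               ≡⟨ disjoint⇒∣p∪q∣≡∣p∣+∣q∣ S T S∩T≡⊥ ⟩
    ∣ S ∣ + ∣ T ∣                           ≤⟨ +-mono-≤ ∣S∣≤rankφS∪T (≤-reflexive (sym indT)) ⟩
    rank N (image φ (S ∪ T)) + rank M T    ≤⟨ mor T (S ∪ T) (q⊆p∪q S T) ⟩
    rank M (S ∪ T) + rank N (image φ T)    ≡⟨ cong (rank M (S ∪ T) +_) rankφT≡0 ⟩
    rank M (S ∪ T) + 0                     ≡⟨ +-identityʳ _ ⟩
    rank M (S ∪ T)                         ∎)
  where open ≤-Reasoning

lemma5p4 : ∀ {n m} (M : Matroid n) (N : Matroid m) (φ : Fin n → Fin m) →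
    IsMorphism M N φ → (I : Subset n) → IsBasisOfSize M N φ (fullRank N) I →
    (I ∩ loops N φ ≡ ⊥) ×
    (∀ (J : Subset n) → J ⊆ loops N φ →
      (IsBasisOf M N φ (I ∪ J) ⇔ IndependentIn M (loops N φ) J))
lemma5p4 M N φ mor I ((_ , spanI) , ∣I∣≡rankN) = I∩L≡⊥ , extension
  where
  I∩L≡⊥ : I ∩ loops N φ ≡ ⊥
  I∩L≡⊥ = image-rank-full⇒no-loops N φ I (trans spanI (sym ∣I∣≡rankN))

  extension : ∀ J → J ⊆ loops N φ → IsBasisOf M N φ (I ∪ J) ⇔ IndependentIn M (loops N φ) J
  extension J J⊆L = mk⇔
    (λ (indI∪J , _) → J⊆L , independent-disjoint-part M I J I∩J≡⊥ indI∪J)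
    (λ (_ , indJ) →
      morphism-extends-independence M N φ mor I J I∩J≡⊥
        (≤-reflexive (trans ∣I∣≡rankN (sym spanI∪J)))
        (loops-image-rank-zero N φ J J⊆L) indJ
      , spanI∪J)
    where
    I∩J≡⊥ : I ∩ J ≡ ⊥
    I∩J≡⊥ = disjoint-⊆ I∩L≡⊥ J⊆L
    spanI∪J : rank N (image φ (I ∪ J)) ≡ fullRank N
    spanI∪J = spanning-superset N φ spanI (p⊆p∪q J)
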